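{- Let $G$ be a graph on $V=V_1\cup V_2\cup V_3$ (a partition) with $|V_i|=n$ for $i\in[3]$. Suppose that $G$ is locally symmetrized and cyclically triangle-free. Let $x_1,y_1,z_1,x_2,y_2,z_2,\dots,x_k,y_k,z_k$ be a distinct directed path in $\vec G$ with $(x_i,y_i,z_i)\in V_1\times V_2\times V_3$ for $i\in[k]$. Suppose that either $N^-(x_1)=\emptyset$ or $N^-(x_1)=[z_k]$. Then $$\sum_{i\in[k]}\big(d_G(x_i)+d_G(y_i)+d_G(z_i)\big)\le 3(k+1)n.$$
   Context: Indices are modulo $3$. $G$ is cyclically triangle-free if no $3$-set spanning a triangle in $G$ has one vertex in each part, or two vertices in $V_1$ and one in $V_2$, or two in $V_2$ and one in $V_3$, or two in $V_3$ and one in $V_1$. Two vertices $u,v$ are equivalent ($u\sim v$) if they lie in the same part $V_i$ and $N_G(u)=N_G(v)$; $[v]$ denotes the equivalence class of $v$ (within its part). $G$ is locally symmetrized if for each $i$, any two nonadjacent vertices of $V_i$ are equivalent. $\vec G$ is the mixed graph obtained from $G$ by orienting every edge between $V_i$ and $V_{i+1}$ from $V_i$ to $V_{i+1}$ and leaving edges inside parts undirected; a directed path $w_1w_2\cdots w_m$ in $\vec G$ is a sequence of vertices such that each $w_jw_{j+1}$ is an edge of $G$ oriented from $w_j$ to $w_{j+1}$ (so here $x_iy_i$, $y_iz_i$, $z_ix_{i+1}$ are edges of $G$); it is distinct if no two of its vertices are equivalent. For $v\in V_i$, $N^-(v)=N_G(v)\cap V_{i-1}$. -}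

module Defs where

open import Data.Nat using (ℕ; zero; suc; _+_; _*_)
open import Data.Fin using (Fin; zero; suc)
open import Data.Fin.Patterns using (0F; 1F; 2F)
open import Data.Bool using (Bool; true; false; if_then_else_)
open import Data.List using (List; map; allFin)
open import Data.Nat.ListAction using (sum)
open import Data.Empty using (⊥)
open import Data.Product using (_×_; _,_; proj₁; proj₂)
open import Relation.Binary.PropositionalEquality using (_≡_)
open import Relation.Nullary using (¬_)

-- Parts are indexed by Fin 3: 0F = V₁, 1F = V₂, 2F = V₃.
-- A vertex is a pair (part, index within part); so |Vᵢ| = n for every i.
Vertex : ℕ → Set
Vertex n = Fin 3 × Fin n

part : ∀ {n} → Vertex n → Fin 3
part = proj₁

next : Fin 3 → Fin 3
next 0F = 1F
next 1F = 2F
next 2F = 0F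

record Graph (n : ℕ) : Set where
  field
    adj    : Vertex n → Vertex n → Bool
    sym    : ∀ u v → adj u v ≡ adj v u
    irrefl : ∀ v → adj v v ≡ false
open Graph public

Adj : ∀ {n} → Graph n → Vertex n → Vertex n → Set
Adj G u v = adj G u v ≡ true

ΣFin : (m : ℕ) → (Fin m → ℕ) → ℕ
ΣFin m f = sum (map f (allFin m))

deg : ∀ {n} → Graph n → Vertex n → ℕ
deg {n} G v = ΣFin 3 (λ p → ΣFin n (λ j → if adj G v (p , j) then 1 else 0))

_∼[_]_ : ∀ {n} → Vertex n → Graph n → Vertex n → Set
u ∼[ G ] v = (part u ≡ part v) × (∀ w → adj G u w ≡ adj G v w)

Triangle : ∀ {n} → Graph n → Vertex n → Vertex n → Vertex n → Set
Triangle G a b c = Adj G a b × Adj G b c × Adj G a c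

CyclicallyTriangleFree : ∀ {n} → Graph n → Set
CyclicallyTriangleFree {n} G =
  (∀ a b c → Triangle G (0F , a) (1F , b) (2F , c) → ⊥)
  × (∀ i a b c → Triangle G (i , a) (i , b) (next i , c) → ⊥)

LocallySymmetrized : ∀ {n} → Graph n → Set
LocallySymmetrized {n} G =
  ∀ i (a b : Fin n) → adj G (i , a) (i , b) ≡ false → (i , a) ∼[ G ] (i , b)

-- x₁y₁z₁…xₖyₖzₖ (k = suc m) is a directed path in G⃗ with xᵢ ∈ V₁, yᵢ ∈ V₂, zᵢ ∈ V₃:
-- xᵢyᵢ, yᵢzᵢ, zᵢxᵢ₊₁ are edges of G (orientation V₁→V₂→V₃→V₁ is automatic).
DirectedPath : ∀ {n} → Graph n → (m : ℕ) → (x y z : Fin (suc m) → Fin n) → Set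
DirectedPath G m x y z =
  (∀ i → Adj G (0F , x i) (1F , y i))
  × (∀ i → Adj G (1F , y i) (2F , z i))
  × (∀ (i : Fin m) → Adj G (2F , z (Data.Fin.inject₁ i)) (0F , x (suc i)))
  where import Data.Fin

-- distinct: no two vertices of the path are equivalent (vertices in
-- different parts are never equivalent, so only same-part pairs matter)
DistinctPath : ∀ {n} → Graph n → (m : ℕ) → (x y z : Fin (suc m) → Fin n) → Set
DistinctPath G m x y z =
  (∀ i j → (0F , x i) ∼[ G ] (0F , x j) → i ≡ j)
  × (∀ i j → (1F , y i) ∼[ G ] (1F , y j) → i ≡ j)
  × (∀ i j → (2F , z i) ∼[ G ] (2F , z j) → i ≡ j)

-- Split each degree by the part the neighbours lie in.  If u ∈ Vₚ and w ∈ Vₚ₊₁ are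
-- adjacent, cyclic triangle-freeness forbids a common neighbour in Vₚ, so their
-- neighbourhoods in Vₚ together have at most n vertices; pairing xᵢ with yᵢ (in V₁),
-- yᵢ with zᵢ (in V₂) and zᵢ with xᵢ₊₁ (in V₃) bounds these terms by 3kn, where the
-- missing pair (zₖ, x₁) is covered by the hypothesis on N⁻(x₁).  The remaining
-- "forward" degrees into Vₚ₊₁ sum to at most n per part: a vertex of Vₚ₊₁ with two
-- neighbours among distinct path vertices of Vₚ would give a cyclic triangle if they
-- are adjacent and, by local symmetrization, an equivalent pair if they are not.
module Submission where

open import Defs
open import Data.Bool using (Bool; true; false; if_then_else_)
open import Data.Empty using (⊥; ⊥-elim)
open import Data.Fin using (Fin; zero; fromℕ; inject₁) renaming (suc to fsuc)
open import Data.Fin.Patterns using (0F; 1F; 2F)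
open import Data.Fin.Properties using (0≢1+n; suc-injective)
open import Data.List using (tabulate)
open import Data.List.Properties using (map-tabulate)
open import Data.Nat using (ℕ; zero; suc; _+_; _*_; _≤_; z≤n)
import Data.Nat.ListAction as List
open import Data.Nat.Properties
  using (+-0-commutativeMonoid; +-mono-≤; +-comm; *-identityʳ; ≤-refl; ≤-reflexive; ≤-trans; module ≤-Reasoning)
open import Algebra.Properties.CommutativeMonoid.Sum +-0-commutativeMonoid
  using (sum; sum-syntax; ∑-distrib-+; ∑-comm; sum-cong-≗; sum-replicate-zero; sum-init-last)
open import Data.Nat.Tactic.RingSolver using (solve-∀)
open import Data.Product using (_,_; proj₂)
open import Data.Sum using (_⊎_; [_,_]′)
open import Function using (_∘_; id; case_of_)
open import Function.Bundles using (_⇔_; Equivalence)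
open import Relation.Binary.PropositionalEquality
  using (_≡_; refl; trans; cong; module ≡-Reasoning) renaming (sym to ≡-sym)

indicator : Bool → ℕ
indicator b = if b then 1 else 0

indicator-+-≤1 : ∀ {a b} → (a ≡ true → b ≡ true → ⊥) → indicator a + indicator b ≤ 1
indicator-+-≤1 {true}  {true}  disjoint = ⊥-elim (disjoint refl refl)
indicator-+-≤1 {true}  {false} _ = ≤-refl
indicator-+-≤1 {false} {true}  _ = ≤-refl
indicator-+-≤1 {false} {false} _ = z≤n

ΣFin≡∑ : ∀ k (f : Fin k → ℕ) → ΣFin k f ≡ ∑[ i < k ] f i
ΣFin≡∑ k f = trans (cong List.sum (map-tabulate id f)) (sum-tabulate k f)
  where
  sum-tabulate : ∀ k (f : Fin k → ℕ) → List.sum (tabulate f) ≡ sum f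
  sum-tabulate zero    f = refl
  sum-tabulate (suc k) f = cong (f zero +_) (sum-tabulate k (f ∘ fsuc))

∑-≤-* : ∀ {k c} (f : Fin k → ℕ) → (∀ i → f i ≤ c) → ∑[ i < k ] f i ≤ k * c
∑-≤-* {zero}  f bounded = z≤n
∑-≤-* {suc k} f bounded = +-mono-≤ (bounded zero) (∑-≤-* (f ∘ fsuc) (bounded ∘ fsuc))

∑-+-≤ : ∀ {k a b} (f g : Fin k → ℕ) → ∑[ i < k ] f i ≤ a → ∑[ i < k ] g i ≤ b
      → ∑[ i < k ] (f i + g i) ≤ a + b
∑-+-≤ {k} f g ∑f≤a ∑g≤b = ≤-trans (≤-reflexive (∑-distrib-+ {k} f g)) (+-mono-≤ ∑f≤a ∑g≤b)

∑-indicator-≡0 : ∀ {k} (b : Fin k → Bool) → (∀ i → b i ≡ true → ⊥)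
                  → ∑[ i < k ] indicator (b i) ≡ 0
∑-indicator-≡0 {k} b false-everywhere =
  trans (sum-cong-≗ {k} (λ i → indicator-false (false-everywhere i))) (sum-replicate-zero k)
  where
  indicator-false : ∀ {a} → (a ≡ true → ⊥) → indicator a ≡ 0
  indicator-false {true}  a≢true = ⊥-elim (a≢true refl)
  indicator-false {false} _      = refl

∑-indicator-≤1 : ∀ {k} (b : Fin k → Bool) → (∀ i j → b i ≡ true → b j ≡ true → i ≡ j)
               → ∑[ i < k ] indicator (b i) ≤ 1
∑-indicator-≤1 {zero}  b _ = z≤n
∑-indicator-≤1 {suc k} b unique with b zero in b₀
... | true  = ≤-reflexive (cong suc (∑-indicator-≡0 (b ∘ fsuc)
                (λ i bᵢ → 0≢1+n (unique zero (fsuc i) b₀ bᵢ))))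
... | false = ∑-indicator-≤1 (b ∘ fsuc)
                (λ i j bᵢ bⱼ → suc-injective (unique (fsuc i) (fsuc j) bᵢ bⱼ))

∑-rotate : ∀ {m} (f g : Fin (suc m) → ℕ)
         → ∑[ i < suc m ] (f i + g i)
           ≡ ∑[ i < m ] (f (inject₁ i) + g (fsuc i)) + (f (fromℕ m) + g zero)
∑-rotate {m} f g = begin
  ∑[ i < suc m ] (f i + g i)                           ≡⟨ ∑-distrib-+ {suc m} f g ⟩
  ∑[ i < suc m ] f i + ∑g                              ≡⟨ cong (_+ ∑g) (sum-init-last {m} f) ⟩
  (∑[ i < m ] f (inject₁ i) + f (fromℕ m)) + (g zero + ∑[ i < m ] g (fsuc i))
    ≡⟨ interchange (∑[ i < m ] f (inject₁ i)) (f (fromℕ m)) (g zero) (∑[ i < m ] g (fsuc i)) ⟩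
  (∑[ i < m ] f (inject₁ i) + ∑[ i < m ] g (fsuc i)) + (f (fromℕ m) + g zero)
    ≡⟨ cong (_+ (f (fromℕ m) + g zero)) (∑-distrib-+ {m} (f ∘ inject₁) (g ∘ fsuc)) ⟨
  ∑[ i < m ] (f (inject₁ i) + g (fsuc i)) + (f (fromℕ m) + g zero) ∎
  where
  open ≡-Reasoning
  ∑g : ℕ
  ∑g = g zero + ∑[ i < m ] g (fsuc i)
  interchange : ∀ a b c d → (a + b) + (c + d) ≡ (a + d) + (b + c)
  interchange = solve-∀

module _ {n} (G : Graph n) where

  degIn : Vertex n → Fin 3 → ℕ
  degIn v p = ∑[ j < n ] indicator (adj G v (p , j))

  deg≡∑degIn : ∀ v → deg G v ≡ ∑[ p < 3 ] degIn v p
  deg≡∑degIn v = trans (ΣFin≡∑ 3 (λ p → ΣFin n (adjacent p)))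
                       (sum-cong-≗ {3} (λ p → ΣFin≡∑ n (adjacent p)))
    where
    adjacent : Fin 3 → Fin n → ℕ
    adjacent p j = indicator (adj G v (p , j))

  deg-triple≡ : ∀ u v w → deg G (0F , u) + deg G (1F , v) + deg G (2F , w)
              ≡ (degIn (0F , u) 0F + degIn (1F , v) 0F)
                + (degIn (1F , v) 1F + degIn (2F , w) 1F)
                + (degIn (2F , w) 2F + degIn (0F , u) 2F)
                + (degIn (0F , u) 1F + degIn (1F , v) 2F + degIn (2F , w) 0F)
  deg-triple≡ u v w
    rewrite deg≡∑degIn (0F , u) | deg≡∑degIn (1F , v) | deg≡∑degIn (2F , w) =
    shuffle (degIn (0F , u) 0F) (degIn (0F , u) 1F) (degIn (0F , u) 2F)
            (degIn (1F , v) 0F) (degIn (1F , v) 1F) (degIn (1F , v) 2F)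
            (degIn (2F , w) 0F) (degIn (2F , w) 1F) (degIn (2F , w) 2F)
    where
    shuffle : ∀ a₀ a₁ a₂ b₀ b₁ b₂ c₀ c₁ c₂
            → (a₀ + (a₁ + (a₂ + 0))) + (b₀ + (b₁ + (b₂ + 0))) + (c₀ + (c₁ + (c₂ + 0)))
              ≡ (a₀ + b₀) + (b₁ + c₁) + (c₂ + a₂) + (a₁ + b₂ + c₀)
    shuffle = solve-∀

  degIn-+-≤ : ∀ u w p → (∀ j → Adj G u (p , j) → Adj G w (p , j) → ⊥)
            → degIn u p + degIn w p ≤ n
  degIn-+-≤ u w p disjoint = begin
    degIn u p + degIn w p                  ≡⟨ ∑-distrib-+ {n} _ _ ⟨
    ∑[ j < n ] (indicator (adj G u (p , j)) + indicator (adj G w (p , j)))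
                                           ≤⟨ ∑-≤-* _ (λ j → indicator-+-≤1 (disjoint j)) ⟩
    n * 1                                  ≡⟨ *-identityʳ n ⟩
    n                                      ∎
    where open ≤-Reasoning

  nbrs∼⇒degIn-+-≤ : ∀ u v p → (∀ j → Adj G u (p , j) → (p , j) ∼[ G ] v)
                  → degIn v p + degIn u p ≤ n
  nbrs∼⇒degIn-+-≤ u v p nbrs∼v = degIn-+-≤ v u p no-common-nbr
    where
    -- A common neighbour j would be equivalent to v, hence adjacent to itself.
    no-common-nbr : ∀ j → Adj G v (p , j) → Adj G u (p , j) → ⊥
    no-common-nbr j v~j u~j with
      trans (≡-sym (irrefl G (p , j))) (trans (proj₂ (nbrs∼v j u~j) (p , j)) v~j)
    ... | ()

  module _ (ctf : CyclicallyTriangleFree G) where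

    degIn-edge : ∀ p u w → Adj G (p , u) (next p , w) → degIn (p , u) p + degIn (next p , w) p ≤ n
    degIn-edge p u w u~w = degIn-+-≤ (p , u) (next p , w) p
      (λ j u~j w~j → proj₂ ctf p u j w (u~j , trans (sym G (p , j) (next p , w)) w~j , u~w))

    ∑degIn-edges-≤ : ∀ p {k} (u w : Fin k → Fin n) → (∀ i → Adj G (p , u i) (next p , w i))
                   → ∑[ i < k ] (degIn (p , u i) p + degIn (next p , w i) p) ≤ k * n
    ∑degIn-edges-≤ p u w edges = ∑-≤-* _ (λ i → degIn-edge p (u i) (w i) (edges i))

    ∑degIn-cycle-≤ : ∀ p {m} (u w : Fin (suc m) → Fin n)
                   → (∀ i → Adj G (p , u (inject₁ i)) (next p , w (fsuc i)))
                   → degIn (p , u (fromℕ m)) p + degIn (next p , w zero) p ≤ n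
                   → ∑[ i < suc m ] (degIn (p , u i) p + degIn (next p , w i) p) ≤ suc m * n
    ∑degIn-cycle-≤ p {m} u w edges closing = begin
      ∑[ i < suc m ] (degIn (p , u i) p + degIn (next p , w i) p)
        ≡⟨ ∑-rotate (λ i → degIn (p , u i) p) (λ i → degIn (next p , w i) p) ⟩
      ∑[ i < m ] (degIn (p , u (inject₁ i)) p + degIn (next p , w (fsuc i)) p)
        + (degIn (p , u (fromℕ m)) p + degIn (next p , w zero) p)
        ≤⟨ +-mono-≤ (∑degIn-edges-≤ p (u ∘ inject₁) (w ∘ fsuc) edges) closing ⟩
      m * n + n
        ≡⟨ +-comm (m * n) n ⟩
      suc m * n ∎
      where open ≤-Reasoning

    ∑degIn-next-≤ : LocallySymmetrized G → ∀ p {k} (v : Fin k → Fin n)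
                  → (∀ i j → (p , v i) ∼[ G ] (p , v j) → i ≡ j)
                  → ∑[ i < k ] degIn (p , v i) (next p) ≤ n
    ∑degIn-next-≤ ls p {k} v distinct = begin
      ∑[ i < k ] degIn (p , v i) (next p)                           ≡⟨ ∑-comm {k} {n} _ ⟩
      ∑[ j < n ] ∑[ i < k ] indicator (adj G (p , v i) (next p , j))
                                     ≤⟨ ∑-≤-* _ (λ j → ∑-indicator-≤1 _ (at-most-one-nbr j)) ⟩
      n * 1                                                         ≡⟨ *-identityʳ n ⟩
      n                                                             ∎
      where
      open ≤-Reasoning
      at-most-one-nbr : ∀ j i i′ → Adj G (p , v i) (next p , j) → Adj G (p , v i′) (next p , j) → i ≡ i′
      at-most-one-nbr j i i′ vᵢ~j vᵢ′~j with adj G (p , v i) (p , v i′) in vᵢ~vᵢ′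
      ... | true  = ⊥-elim (proj₂ ctf p (v i) (v i′) j (vᵢ~vᵢ′ , vᵢ′~j , vᵢ~j))
      ... | false = distinct i i′ (ls p (v i) (v i′) vᵢ~vᵢ′)

lemma2p7 : (n : ℕ) (G : Graph n)
    → LocallySymmetrized G
    → CyclicallyTriangleFree G
    → (m : ℕ) (x y z : Fin (suc m) → Fin n)
    → DirectedPath G m x y z
    → DistinctPath G m x y z
    → (∀ (w : Fin n) → adj G (0F , x zero) (2F , w) ≡ false)
      ⊎ (∀ (w : Fin n) → (Adj G (0F , x zero) (2F , w) ⇔ (2F , w) ∼[ G ] (2F , z (fromℕ m))))
    → ΣFin (suc m) (λ i → deg G (0F , x i) + deg G (1F , y i) + deg G (2F , z i))
      ≤ 3 * (suc m + 1) * n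
lemma2p7 n G ls ctf m x y z (x~y , y~z , z~x) (distinct-x , distinct-y , distinct-z) N⁻x₁ = begin
  ΣFin K (λ i → deg G (0F , x i) + deg G (1F , y i) + deg G (2F , z i))
    ≡⟨ trans (ΣFin≡∑ K _) (sum-cong-≗ {K} (λ i → deg-triple≡ G (x i) (y i) (z i))) ⟩
  ∑[ i < K ] (inV₁ i + inV₂ i + inV₃ i + (fwd₁ i + fwd₂ i + fwd₃ i))
    ≤⟨ ∑-+-≤ (λ i → inV₁ i + inV₂ i + inV₃ i) (λ i → fwd₁ i + fwd₂ i + fwd₃ i)
         (∑-+-≤ (λ i → inV₁ i + inV₂ i) inV₃
           (∑-+-≤ inV₁ inV₂ (∑degIn-edges-≤ G ctf 0F x y x~y) (∑degIn-edges-≤ G ctf 1F y z y~z))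
           (∑degIn-cycle-≤ G ctf 2F z x z~x (nbrs∼⇒degIn-+-≤ G _ _ 2F N⁻x₁⊆[zₖ])))
         (∑-+-≤ (λ i → fwd₁ i + fwd₂ i) fwd₃
           (∑-+-≤ fwd₁ fwd₂ (∑degIn-next-≤ G ctf ls 0F x distinct-x) (∑degIn-next-≤ G ctf ls 1F y distinct-y))
           (∑degIn-next-≤ G ctf ls 2F z distinct-z)) ⟩
  K * n + K * n + K * n + (n + n + n)
    ≡⟨ total K n ⟩
  3 * (K + 1) * n ∎
  where
  open ≤-Reasoning
  K : ℕ
  K = suc m
  inV₁ inV₂ inV₃ fwd₁ fwd₂ fwd₃ : Fin K → ℕ
  inV₁ i = degIn G (0F , x i) 0F + degIn G (1F , y i) 0F
  inV₂ i = degIn G (1F , y i) 1F + degIn G (2F , z i) 1F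
  inV₃ i = degIn G (2F , z i) 2F + degIn G (0F , x i) 2F
  fwd₁ i = degIn G (0F , x i) 1F
  fwd₂ i = degIn G (1F , y i) 2F
  fwd₃ i = degIn G (2F , z i) 0F

  N⁻x₁⊆[zₖ] : ∀ j → Adj G (0F , x zero) (2F , j) → (2F , j) ∼[ G ] (2F , z (fromℕ m))
  N⁻x₁⊆[zₖ] j = [ (λ no-in-nbrs x₁~j → case trans (≡-sym (no-in-nbrs j)) x₁~j of λ ())
                , (λ in-nbrs∼zₖ → Equivalence.to (in-nbrs∼zₖ j))
                ]′ N⁻x₁

  total : ∀ K n → K * n + K * n + K * n + (n + n + n) ≡ 3 * (K + 1) * n
  total = solve-∀
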